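{- Let $q\in\mathbb{Z}$ and let $s$ be a positive integer. Suppose that either $(G_n)_{n\ge0}$ is defined by $G_0=0$, $G_1=1$, $G_n=G_{n-1}+qG_{n-2}$ for $n\ge2$, and $s\mid 4q+1$; or $(G_n)_{n\ge0}$ is defined by $G_0=0$, $G_1=1$, $G_n=2G_{n-1}+qG_{n-2}$ for $n\ge2$, and $s\mid q+1$. Then: (1) For all integers $n\ge0$: $s\mid n$ if and only if $s\mid G_n$. (2) If $3\nmid q+1$ or $3\nmid s$, then for all integers $k,n\ge0$: $s^k\mid n$ if and only if $s^k\mid G_n$.
   Context: For integers $a,b$, $a\mid b$ means there is an integer $c$ with $b=ca$ (in particular $0\mid 0$). -}

module Defs where

open import Data.Nat using (ℕ; zero; suc)
open import Data.Integer using (ℤ; +_; _+_; _*_)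

G : ℤ → ℤ → ℕ → ℤ
G a q zero = + 0
G a q (suc zero) = + 1
G a q (suc (suc n)) = a * G a q (suc n) + q * G a q n

-- The case a = 1 reduces to a = 2, because 2ⁿ⁻¹·Gₙ(1, q) = Gₙ(2, 4q)
-- and s is odd.  For a = 2 put m = q + 1, gₙ = Gₙ and wₙ = gₙ₊₁ - gₙ, so that
-- (1 + √m)ⁿ = wₙ + gₙ√m; the pair (w, g) obeys the corresponding addition
-- formula.  Modulo any divisor of m this gives wₙ ≡ 1 and gₙ ≡ n: part (1).
-- For part (2), the first-order expansion of (w_N + g_N√m)ʳ shows that
-- g_N ≡ d (mod s·d) propagates to g_(rN) ≡ r·d (mod s·d), and that the
-- congruences at N = sʲ lift from level j to j + 1 once j ≥ 1.  The first
-- level g_s ≡ s (mod s²) comes from the second-order expansion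
-- gₙ ≡ n + m·C(n,3) (mod m²) together with s ∣ C(s,3), which needs 3 ∤ s.
-- Hence gₙ ≡ n (mod sʲ⁺¹) whenever sʲ ∣ n, and induction on k concludes.
module Submission where

open import Defs
open import Data.Nat using (ℕ; _≥_)
open import Data.Integer using (ℤ; +_; _+_; _*_; _^_)
open import Data.Integer.Divisibility using (_∣_)
open import Data.Product using (_×_)
open import Data.Sum using (_⊎_)
open import Relation.Binary.PropositionalEquality using (_≡_)
open import Relation.Nullary using (¬_)
open import Function.Bundles using (_⇔_)

open import Data.Nat using (zero; suc; s≤s; z≤n)
import Data.Nat as ℕ
import Data.Nat.Properties as ℕP
import Data.Nat.Divisibility as ℕD
open import Data.Nat.Combinatorics using (_C_; nC1≡n; nCk+nC[k+1]≡[n+1]C[k+1])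
open import Data.Nat.Coprimality using (Coprime; coprime-divisor)
open import Data.Nat.Primality using (irreducible?)
open import Data.Integer using (_-_; -_)
import Data.Integer as ℤ
import Data.Integer.Properties as ZP
open import Data.Integer.Divisibility.Signed as Signed
  using (divides; ∣-refl; ∣-trans; ∣m⇒∣m*n; ∣n⇒∣m*n; *-monoʳ-∣; *-monoˡ-∣)
  renaming (_∣_ to _∣ₛ_)
import Data.Integer.Tactic.RingSolver as ℤRing
import Data.Nat.Tactic.RingSolver as ℕRing
open import Data.Product using (Σ; _,_; proj₁; proj₂)
open import Data.Sum using (inj₁; inj₂)
open import Data.Empty using (⊥-elim)
open import Level using (0ℓ)
open import Relation.Binary.Bundles using (Setoid)
import Relation.Binary.Reasoning.Setoid as SetoidReasoning
open import Relation.Binary.PropositionalEquality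
  using (refl; sym; trans; cong; cong₂; subst; subst₂; module ≡-Reasoning)
open import Relation.Nullary.Decidable using (from-yes)
open import Function.Bundles using (mk⇔; Equivalence)
open import Function.Properties.Equivalence using () renaming (sym to ⇔-sym; trans to ⇔-trans)

-- x ≡ y (mod M): the modulus divides the difference.  Wrapping the
-- divisibility in a record lets Agda infer x, y and M from the type.
infix 4 _≡_[mod_]
record _≡_[mod_] (x y M : ℤ) : Set where
  constructor congruent
  field difference : M ∣ₛ x - y

∣0 : ∀ M → M ∣ₛ + 0
∣0 M = divides (+ 0) (sym (ZP.*-zeroˡ M))

1∣ : ∀ x → + 1 ∣ₛ x
1∣ x = divides x (sym (ZP.*-identityʳ x))

*-pres-∣ : ∀ {a b x y} → a ∣ₛ x → b ∣ₛ y → a * b ∣ₛ x * y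
*-pres-∣ {a} {b} {x} {y} a∣x b∣y = ∣-trans (*-monoʳ-∣ a b∣y) (*-monoˡ-∣ y a∣x)

∣-by : ∀ {M x y} → x ≡ y → M ∣ₛ y → M ∣ₛ x
∣-by {M} eq = subst (M ∣ₛ_) (sym eq)

mod-reflexive : ∀ {M x y} → x ≡ y → x ≡ y [mod M ]
mod-reflexive {M} {x} refl = congruent (∣-by (ZP.+-inverseʳ x) (∣0 M))

mod-refl : ∀ {M x} → x ≡ x [mod M ]
mod-refl = mod-reflexive refl

mod-sym : ∀ {M x y} → x ≡ y [mod M ] → y ≡ x [mod M ]
mod-sym {M} {x} {y} (congruent p) = congruent (∣-by (negate x y) (Signed.∣m⇒∣-m p))
  where
  negate : ∀ x y → y - x ≡ - (x - y)
  negate = ℤRing.solve-∀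

mod-trans : ∀ {M x y z} → x ≡ y [mod M ] → y ≡ z [mod M ] → x ≡ z [mod M ]
mod-trans {M} {x} {y} {z} (congruent p) (congruent q) =
  congruent (∣-by (telescope x y z) (Signed.∣m∣n⇒∣m+n p q))
  where
  telescope : ∀ x y z → x - z ≡ (x - y) + (y - z)
  telescope = ℤRing.solve-∀

mod-setoid : ℤ → Setoid 0ℓ 0ℓ
mod-setoid M = record
  { Carrier       = ℤ
  ; _≈_           = λ x y → x ≡ y [mod M ]
  ; isEquivalence = record { refl = mod-refl ; sym = mod-sym ; trans = mod-trans }
  }

module ModReasoning (M : ℤ) = SetoidReasoning (mod-setoid M)

+-cong : ∀ {M x y u v} → x ≡ y [mod M ] → u ≡ v [mod M ] → x + u ≡ y + v [mod M ]
+-cong {M} {x} {y} {u} {v} (congruent p) (congruent q) =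
  congruent (∣-by (regroup x y u v) (Signed.∣m∣n⇒∣m+n p q))
  where
  regroup : ∀ x y u v → (x + u) - (y + v) ≡ (x - y) + (u - v)
  regroup = ℤRing.solve-∀

*-cong : ∀ {M x y u v} → x ≡ y [mod M ] → u ≡ v [mod M ] → x * u ≡ y * v [mod M ]
*-cong {M} {x} {y} {u} {v} (congruent p) (congruent q) =
  congruent (∣-by (regroup x y u v) (Signed.∣m∣n⇒∣m+n (∣n⇒∣m*n x q) (∣m⇒∣m*n v p)))
  where
  regroup : ∀ x y u v → x * u - y * v ≡ x * (u - v) + (x - y) * v
  regroup = ℤRing.solve-∀

+-congˡ : ∀ {M u v} x → u ≡ v [mod M ] → x + u ≡ x + v [mod M ]
+-congˡ x = +-cong (mod-reflexive {x = x} refl)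

*-congˡ : ∀ {M u v} x → u ≡ v [mod M ] → x * u ≡ x * v [mod M ]
*-congˡ x = *-cong (mod-reflexive {x = x} refl)

*-congʳ : ∀ {M x y} u → x ≡ y [mod M ] → x * u ≡ y * u [mod M ]
*-congʳ u p = *-cong p (mod-reflexive {x = u} refl)

mod-weaken : ∀ {D M x y} → D ∣ₛ M → x ≡ y [mod M ] → x ≡ y [mod D ]
mod-weaken D∣M (congruent p) = congruent (∣-trans D∣M p)

mod-scale : ∀ {M x y} c → x ≡ y [mod M ] → c * x ≡ c * y [mod c * M ]
mod-scale {M} {x} {y} c (congruent p) = congruent (∣-by (distrib c x y) (*-monoʳ-∣ c p))
  where
  distrib : ∀ c x y → c * x - c * y ≡ c * (x - y)
  distrib = ℤRing.solve-∀

mod-scale-multiple : ∀ {A B x y c} → A ∣ₛ c → x ≡ y [mod B ] → c * x ≡ c * y [mod B * A ]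
mod-scale-multiple {A} {B} {x} {y} {c} A∣c (congruent p) =
  congruent (∣-by (regroup c x y) (*-pres-∣ p A∣c))
  where
  regroup : ∀ c x y → c * x - c * y ≡ (x - y) * c
  regroup = ℤRing.solve-∀

mod-absorb : ∀ {M z} x → M ∣ₛ z → x + z ≡ x [mod M ]
mod-absorb {M} {z} x M∣z = congruent (∣-by (regroup x z) M∣z)
  where
  regroup : ∀ x z → x + z - x ≡ z
  regroup = ℤRing.solve-∀

pow-≡1 : ∀ {M x} e → x ≡ + 1 [mod M ] → x ^ e ≡ + 1 [mod M ]
pow-≡1 zero    p = mod-refl
pow-≡1 (suc e) p = *-cong p (pow-≡1 e p)

mod-divides : ∀ {M x y} → x ≡ y [mod M ] → (M ∣ₛ x ⇔ M ∣ₛ y)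
mod-divides {M} {x} {y} (congruent p) = mk⇔
  (λ M∣x → ∣-by (back x y) (Signed.∣m∣n⇒∣m-n M∣x p))
  (λ M∣y → ∣-by (forth x y) (Signed.∣m∣n⇒∣m+n p M∣y))
  where
  back : ∀ x y → y ≡ x - (x - y)
  back = ℤRing.solve-∀
  forth : ∀ x y → x ≡ (x - y) + y
  forth = ℤRing.solve-∀

∣-transfer : ∀ {D M x y} → D ∣ₛ M → x ≡ y [mod M ] → D ∣ₛ y → D ∣ₛ x
∣-transfer D∣M p = Equivalence.from (mod-divides (mod-weaken D∣M p))


pos-pow : ∀ s j → + (s ℕ.^ j) ≡ (+ s) ^ j
pos-pow s zero    = refl
pos-pow s (suc j) = trans (ZP.pos-* s (s ℕ.^ j)) (cong (+ s *_) (pos-pow s j))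

pow-multiple : ∀ s j n → (+ s) ^ j ∣ₛ + n → Σ ℕ λ r → n ≡ r ℕ.* s ℕ.^ j
pow-multiple s j n S^j∣n with Signed.∣⇒∣ᵤ S^j∣n
... | ℕD.divides r eq = r , trans eq (cong (λ x → r ℕ.* ℤ.∣ x ∣) (sym (pos-pow s j)))

-- Geometric sums and lifting the exponent.

geom : ℤ → ℕ → ℤ
geom W zero    = + 0
geom W (suc e) = + 1 + W * geom W e

geom-identity : ∀ W e → W ^ e - + 1 ≡ geom W e * (W - + 1)
geom-identity W zero    = sym (ZP.*-zeroˡ (W - + 1))
geom-identity W (suc e) = begin
  W * W ^ e - + 1                        ≡⟨ split W (W ^ e) ⟩
  W * (W ^ e - + 1) + (W - + 1)          ≡⟨ cong (λ t → W * t + (W - + 1)) (geom-identity W e) ⟩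
  W * (geom W e * (W - + 1)) + (W - + 1) ≡⟨ collect W (geom W e) ⟩
  (+ 1 + W * geom W e) * (W - + 1)       ∎
  where
  open ≡-Reasoning
  split : ∀ W P → W * P - + 1 ≡ W * (P - + 1) + (W - + 1)
  split = ℤRing.solve-∀
  collect : ∀ W g → W * (g * (W - + 1)) + (W - + 1) ≡ (+ 1 + W * g) * (W - + 1)
  collect = ℤRing.solve-∀

-- Modulo W - 1 every term of the geometric sum is 1, so geom W e ≡ e.
geom≡length : ∀ W e → geom W e ≡ + e [mod W - + 1 ]
geom≡length W zero    = mod-refl
geom≡length W (suc e) = begin
  + 1 + W * geom W e  ≈⟨ +-congˡ (+ 1) (*-cong W≡1 (geom≡length W e)) ⟩
  + 1 + + 1 * + e     ≡⟨ cong (_+_ (+ 1)) (ZP.*-identityˡ (+ e)) ⟩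
  + suc e             ∎
  where
  open ModReasoning (W - + 1)
  W≡1 : W ≡ + 1 [mod W - + 1 ]
  W≡1 = congruent ∣-refl

-- Lifting the exponent: if W ≡ 1 modulo D and modulo e, then W^e ≡ 1
-- modulo e·D (the geometric sum contributes the extra factor e).
pow-lift : ∀ {D} e W → W ≡ + 1 [mod D ] → W ≡ + 1 [mod + e ] → W ^ e ≡ + 1 [mod + e * D ]
pow-lift e W (congruent D∣W-1) (congruent e∣W-1) =
  congruent (∣-by (geom-identity W e) (*-pres-∣ e∣geom D∣W-1))
  where
  e∣geom : + e ∣ₛ geom W e
  e∣geom = ∣-transfer e∣W-1 (geom≡length W e) ∣-refl

C₂-suc : ∀ n → suc n C 2 ≡ n ℕ.+ n C 2
C₂-suc n = trans (sym (nCk+nC[k+1]≡[n+1]C[k+1] n 1)) (cong (ℕ._+ n C 2) (nC1≡n n))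

C₃-suc : ∀ n → suc n C 3 ≡ n C 2 ℕ.+ n C 3
C₃-suc n = sym (nCk+nC[k+1]≡[n+1]C[k+1] n 2)

-- 2·C(n,2) = n(n-1), stated without subtraction.
C₂-closed : ∀ n → 2 ℕ.* (n C 2) ℕ.+ n ≡ n ℕ.* n
C₂-closed zero    = refl
C₂-closed (suc n) = begin
  2 ℕ.* (suc n C 2) ℕ.+ suc n                   ≡⟨ cong (λ c → 2 ℕ.* c ℕ.+ suc n) (C₂-suc n) ⟩
  2 ℕ.* (n ℕ.+ n C 2) ℕ.+ (1 ℕ.+ n)             ≡⟨ regroup n (n C 2) ⟩
  (2 ℕ.* (n C 2) ℕ.+ n) ℕ.+ (2 ℕ.* n ℕ.+ 1)     ≡⟨ cong (ℕ._+ (2 ℕ.* n ℕ.+ 1)) (C₂-closed n) ⟩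
  n ℕ.* n ℕ.+ (2 ℕ.* n ℕ.+ 1)                   ≡⟨ square n ⟩
  (1 ℕ.+ n) ℕ.* (1 ℕ.+ n)                       ∎
  where
  open ≡-Reasoning
  regroup : ∀ n c → 2 ℕ.* (n ℕ.+ c) ℕ.+ (1 ℕ.+ n) ≡ (2 ℕ.* c ℕ.+ n) ℕ.+ (2 ℕ.* n ℕ.+ 1)
  regroup = ℕRing.solve-∀
  square : ∀ n → n ℕ.* n ℕ.+ (2 ℕ.* n ℕ.+ 1) ≡ (1 ℕ.+ n) ℕ.* (1 ℕ.+ n)
  square = ℕRing.solve-∀

C₃-absorption : ∀ n → 3 ℕ.* (suc n C 3) ≡ suc n ℕ.* (n C 2)
C₃-absorption zero    = refl
C₃-absorption (suc n) = begin
  3 ℕ.* (suc (suc n) C 3)                            ≡⟨ cong (3 ℕ.*_) (C₃-suc (suc n)) ⟩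
  3 ℕ.* (suc n C 2 ℕ.+ suc n C 3)                    ≡⟨ ℕP.*-distribˡ-+ 3 (suc n C 2) (suc n C 3) ⟩
  3 ℕ.* (suc n C 2) ℕ.+ 3 ℕ.* (suc n C 3)            ≡⟨ cong₂ (λ a b → 3 ℕ.* a ℕ.+ b) (C₂-suc n) (C₃-absorption n) ⟩
  3 ℕ.* (n ℕ.+ c) ℕ.+ (1 ℕ.+ n) ℕ.* c               ≡⟨ regroup n c ⟩
  (2 ℕ.* c ℕ.+ n) ℕ.+ (2 ℕ.* n ℕ.+ (2 ℕ.+ n) ℕ.* c) ≡⟨ cong (ℕ._+ (2 ℕ.* n ℕ.+ (2 ℕ.+ n) ℕ.* c)) (C₂-closed n) ⟩
  n ℕ.* n ℕ.+ (2 ℕ.* n ℕ.+ (2 ℕ.+ n) ℕ.* c)         ≡⟨ expand n c ⟩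
  (2 ℕ.+ n) ℕ.* (n ℕ.+ c)                           ≡⟨ cong ((2 ℕ.+ n) ℕ.*_) (C₂-suc n) ⟨
  suc (suc n) ℕ.* (suc n C 2)                        ∎
  where
  open ≡-Reasoning
  c : ℕ
  c = n C 2
  regroup : ∀ n c → 3 ℕ.* (n ℕ.+ c) ℕ.+ (1 ℕ.+ n) ℕ.* c ≡ (2 ℕ.* c ℕ.+ n) ℕ.+ (2 ℕ.* n ℕ.+ (2 ℕ.+ n) ℕ.* c)
  regroup = ℕRing.solve-∀
  expand : ∀ n c → n ℕ.* n ℕ.+ (2 ℕ.* n ℕ.+ (2 ℕ.+ n) ℕ.* c) ≡ (2 ℕ.+ n) ℕ.* (n ℕ.+ c)
  expand = ℕRing.solve-∀

coprime-to-3 : ∀ {n} → ¬ 3 ℕD.∣ n → Coprime n 3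
coprime-to-3 3∤n (d∣n , d∣3) with from-yes (irreducible? 3) d∣3
... | inj₁ d≡1 = d≡1
... | inj₂ refl = ⊥-elim (3∤n d∣n)

-- n divides C(n,3) whenever 3 ∤ n: by absorption n ∣ 3·C(n,3).
∣-C₃ : ∀ n → ¬ 3 ℕD.∣ n → n ℕD.∣ n C 3
∣-C₃ zero    _   = ℕD.∣-refl
∣-C₃ (suc n) 3∤n = coprime-divisor (coprime-to-3 3∤n)
  (ℕD.divides (n C 2) (trans (C₃-absorption n) (ℕP.*-comm (suc n) (n C 2))))

-- The sequence with a = 2.  For G₀ = 0, G₁ = 1, Gₙ₊₂ = 2Gₙ₊₁ + qGₙ and m = q + 1, the pair
-- (wₙ, gₙ) with gₙ = Gₙ and wₙ = Gₙ₊₁ - Gₙ describes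
-- (1 + √m)ⁿ = wₙ + gₙ√m; the addition formula below is the product rule
-- for these powers.
module LucasSequence (q : ℤ) where

  m : ℤ
  m = q + + 1

  g : ℕ → ℤ
  g = G (+ 2) q

  w : ℕ → ℤ
  w n = g (suc n) - g n

  g-suc : ∀ n → g (suc n) ≡ g n + w n
  g-suc n = split (g (suc n)) (g n)
    where
    split : ∀ a b → a ≡ b + (a - b)
    split = ℤRing.solve-∀

  w-suc : ∀ n → w (suc n) ≡ w n + m * g n
  w-suc n = rearrange (g (suc n)) (g n) q
    where
    rearrange : ∀ a b q → + 2 * a + q * b - a ≡ a - b + (q + + 1) * b
    rearrange = ℤRing.solve-∀

  addition : ∀ a b → (g (a ℕ.+ b) ≡ g a * w b + g b * w a)
                   × (w (a ℕ.+ b) ≡ w a * w b + m * g a * g b)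
  addition zero b = sym (unit-g (g b) (w b)) , sym (unit-w (g b) (w b) m)
    where
    unit-g : ∀ g w → + 0 * w + g * (+ 1 - + 0) ≡ g
    unit-g = ℤRing.solve-∀
    unit-w : ∀ g w m → (+ 1 - + 0) * w + m * + 0 * g ≡ w
    unit-w = ℤRing.solve-∀
  addition (suc a) b = g-sum , w-sum
    where
    open ≡-Reasoning
    ih : (g (a ℕ.+ b) ≡ g a * w b + g b * w a) × (w (a ℕ.+ b) ≡ w a * w b + m * g a * g b)
    ih = addition a b
    g-sum : g (suc a ℕ.+ b) ≡ g (suc a) * w b + g b * w (suc a)
    g-sum = begin
      g (suc (a ℕ.+ b))                                            ≡⟨ g-suc (a ℕ.+ b) ⟩
      g (a ℕ.+ b) + w (a ℕ.+ b)                                    ≡⟨ cong₂ _+_ (proj₁ ih) (proj₂ ih) ⟩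
      (g a * w b + g b * w a) + (w a * w b + m * g a * g b)        ≡⟨ regroup (g a) (w a) (g b) (w b) m ⟩
      (g a + w a) * w b + g b * (w a + m * g a)                    ≡⟨ cong₂ (λ x y → x * w b + g b * y) (g-suc a) (w-suc a) ⟨
      g (suc a) * w b + g b * w (suc a)                            ∎
      where
      regroup : ∀ ga wa gb wb m → (ga * wb + gb * wa) + (wa * wb + m * ga * gb)
                                  ≡ (ga + wa) * wb + gb * (wa + m * ga)
      regroup = ℤRing.solve-∀
    w-sum : w (suc a ℕ.+ b) ≡ w (suc a) * w b + m * g (suc a) * g b
    w-sum = begin
      w (suc (a ℕ.+ b))                                            ≡⟨ w-suc (a ℕ.+ b) ⟩
      w (a ℕ.+ b) + m * g (a ℕ.+ b)                                ≡⟨ cong₂ (λ x y → x + m * y) (proj₂ ih) (proj₁ ih) ⟩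
      (w a * w b + m * g a * g b) + m * (g a * w b + g b * w a)    ≡⟨ regroup (g a) (w a) (g b) (w b) m ⟩
      (w a + m * g a) * w b + m * (g a + w a) * g b                ≡⟨ cong₂ (λ x y → x * w b + m * y * g b) (w-suc a) (g-suc a) ⟨
      w (suc a) * w b + m * g (suc a) * g b                        ∎
      where
      regroup : ∀ ga wa gb wb m → (wa * wb + m * ga * gb) + m * (ga * wb + gb * wa)
                                  ≡ (wa + m * ga) * wb + m * (ga + wa) * gb
      regroup = ℤRing.solve-∀

  -- Modulo any divisor M of m, √m vanishes: wₙ ≡ 1 and gₙ ≡ n.
  w≡1 : ∀ {M} → M ∣ₛ m → ∀ n → w n ≡ + 1 [mod M ]
  w≡1 M∣m zero    = mod-refl
  w≡1 {M} M∣m (suc n) = begin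
    w (suc n)       ≡⟨ w-suc n ⟩
    w n + m * g n   ≈⟨ mod-absorb (w n) (∣m⇒∣m*n (g n) M∣m) ⟩
    w n             ≈⟨ w≡1 M∣m n ⟩
    + 1             ∎
    where open ModReasoning M

  g≡n : ∀ {M} → M ∣ₛ m → ∀ n → g n ≡ + n [mod M ]
  g≡n M∣m zero    = mod-refl
  g≡n {M} M∣m (suc n) = begin
    g (suc n)   ≡⟨ g-suc n ⟩
    g n + w n   ≈⟨ +-cong (g≡n M∣m n) (w≡1 M∣m n) ⟩
    + n + + 1   ≡⟨ ZP.+-comm (+ n) (+ 1) ⟩
    + suc n     ∎
    where open ModReasoning M

  divisibility : ∀ {M} → M ∣ₛ m → ∀ n → M ∣ₛ + n ⇔ M ∣ₛ g n
  divisibility M∣m n = ⇔-sym (mod-divides (g≡n M∣m n))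

  -- First-order expansion of (wₙ + gₙ√m)^(r+1) when m·gₙ² vanishes:
  -- g((r+1)N) ≡ (r+1)·g_N·w_N^r and w((r+1)N) ≡ w_N^(r+1).
  expansion : ∀ {M} N → M ∣ₛ m * (g N * g N) → ∀ r →
              (g (suc r ℕ.* N) ≡ + suc r * g N * w N ^ r [mod M ])
            × (w (suc r ℕ.* N) ≡ w N ^ suc r [mod M ])
  expansion N _ zero rewrite ℕP.+-identityʳ N =
    mod-reflexive (unit (g N)) , mod-reflexive (sym (ZP.*-identityʳ (w N)))
    where
    unit : ∀ x → x ≡ + 1 * x * + 1
    unit = ℤRing.solve-∀
  expansion {M} N M∣mG² (suc r) = g-step , w-step
    where
    open ModReasoning M
    n : ℕ
    n = suc r ℕ.* N
    G′ W : ℤ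
    G′ = g N
    W = w N
    ih : (g n ≡ + suc r * G′ * W ^ r [mod M ]) × (w n ≡ W ^ suc r [mod M ])
    ih = expansion N M∣mG² r
    g-step : g (N ℕ.+ n) ≡ + suc (suc r) * G′ * W ^ suc r [mod M ]
    g-step = begin
      g (N ℕ.+ n)                                ≡⟨ proj₁ (addition N n) ⟩
      G′ * w n + g n * W                         ≈⟨ +-cong (*-congˡ G′ (proj₂ ih)) (*-congʳ W (proj₁ ih)) ⟩
      G′ * (W * W ^ r) + + suc r * G′ * W ^ r * W ≡⟨ collect G′ W (W ^ r) (+ suc r) ⟩
      (+ 1 + + suc r) * G′ * (W * W ^ r)         ∎
      where
      collect : ∀ G W P x → G * (W * P) + x * G * P * W ≡ (+ 1 + x) * G * (W * P)
      collect = ℤRing.solve-∀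
    w-step : w (N ℕ.+ n) ≡ W ^ suc (suc r) [mod M ]
    w-step = begin
      w (N ℕ.+ n)                                          ≡⟨ proj₂ (addition N n) ⟩
      W * w n + m * G′ * g n                               ≈⟨ +-cong (*-congˡ W (proj₂ ih)) (*-congˡ (m * G′) (proj₁ ih)) ⟩
      W * W ^ suc r + m * G′ * (+ suc r * G′ * W ^ r)      ≡⟨ regroup W (W ^ suc r) m G′ (+ suc r) (W ^ r) ⟩
      W * W ^ suc r + m * (G′ * G′) * (+ suc r * W ^ r)    ≈⟨ mod-absorb (W * W ^ suc r) (∣m⇒∣m*n (+ suc r * W ^ r) M∣mG²) ⟩
      W ^ suc (suc r)                                      ∎
      where
      regroup : ∀ W P m G x Q → W * P + m * G * (x * G * Q) ≡ W * P + m * (G * G) * (x * Q)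
      regroup = ℤRing.solve-∀

  second-order : ∀ n → (g n ≡ + n + m * + (n C 3) [mod m * m ])
                     × (w n ≡ + 1 + m * + (n C 2) [mod m * m ])
  second-order zero = mod-reflexive (sym (vanish (+ 0) m)) , mod-reflexive (sym (vanish (+ 1) m))
    where
    vanish : ∀ a m → a + m * + 0 ≡ a
    vanish = ℤRing.solve-∀
  second-order (suc n) = g-next , w-next
    where
    open ModReasoning (m * m)
    c₂ c₃ : ℤ
    c₂ = + (n C 2)
    c₃ = + (n C 3)
    ih : (g n ≡ + n + m * c₃ [mod m * m ]) × (w n ≡ + 1 + m * c₂ [mod m * m ])
    ih = second-order n
    g-next : g (suc n) ≡ + suc n + m * + (suc n C 3) [mod m * m ]
    g-next = begin
      g (suc n)                          ≡⟨ g-suc n ⟩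
      g n + w n                          ≈⟨ +-cong (proj₁ ih) (proj₂ ih) ⟩
      (+ n + m * c₃) + (+ 1 + m * c₂)    ≡⟨ regroup (+ n) c₂ c₃ m ⟩
      + 1 + + n + m * (c₂ + c₃)          ≡⟨ cong (λ c → + suc n + m * + c) (C₃-suc n) ⟨
      + suc n + m * + (suc n C 3)        ∎
      where
      regroup : ∀ n c₂ c₃ m → (n + m * c₃) + (+ 1 + m * c₂) ≡ + 1 + n + m * (c₂ + c₃)
      regroup = ℤRing.solve-∀
    w-next : w (suc n) ≡ + 1 + m * + (suc n C 2) [mod m * m ]
    w-next = begin
      w (suc n)                              ≡⟨ w-suc n ⟩
      w n + m * g n                          ≈⟨ +-cong (proj₂ ih) (*-congˡ m (proj₁ ih)) ⟩
      (+ 1 + m * c₂) + m * (+ n + m * c₃)    ≡⟨ regroup (+ n) c₂ c₃ m ⟩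
      (+ 1 + m * (+ n + c₂)) + m * m * c₃    ≈⟨ mod-absorb (+ 1 + m * (+ n + c₂)) (∣m⇒∣m*n c₃ ∣-refl) ⟩
      + 1 + m * (+ n + c₂)                   ≡⟨ cong (λ c → + 1 + m * + c) (C₂-suc n) ⟨
      + 1 + m * + (suc n C 2)                ∎
      where
      regroup : ∀ n c₂ c₃ m → (+ 1 + m * c₂) + m * (n + m * c₃) ≡ (+ 1 + m * (n + c₂)) + m * m * c₃
      regroup = ℤRing.solve-∀

-- Lifting to powers of a divisor s of m.

module Lifting (q : ℤ) (s₀ : ℕ) where
  open LucasSequence q

  s : ℕ
  s = suc s₀

  S : ℤ
  S = + s

  module _ (S∣m : S ∣ₛ m) where

    multiples : ∀ N d → g N ≡ d [mod S * d ] → ∀ r → g (r ℕ.* N) ≡ + r * d [mod S * d ]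
    multiples N d g≡d zero    = mod-reflexive (sym (ZP.*-zeroˡ d))
    multiples N d g≡d (suc r) = begin
      g (suc r ℕ.* N)            ≈⟨ proj₁ (expansion N bound r) ⟩
      + suc r * g N * w N ^ r    ≈⟨ *-congʳ (w N ^ r) (*-congˡ (+ suc r) g≡d) ⟩
      + suc r * d * w N ^ r      ≈⟨ mod-scale-multiple (∣n⇒∣m*n (+ suc r) ∣-refl) (pow-≡1 r (w≡1 S∣m N)) ⟩
      + suc r * d * + 1          ≡⟨ ZP.*-identityʳ (+ suc r * d) ⟩
      + suc r * d                ∎
      where
      open ModReasoning (S * d)
      d∣G : d ∣ₛ g N
      d∣G = ∣-transfer (∣n⇒∣m*n S ∣-refl) g≡d ∣-refl
      bound : S * d ∣ₛ m * (g N * g N)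
      bound = *-pres-∣ S∣m (∣m⇒∣m*n (g N) d∣G)

    lift-step : ∀ N D → S ∣ₛ D → g N ≡ D [mod S * D ] → w N ≡ + 1 [mod D ]
              → (g (s ℕ.* N) ≡ S * D [mod S * (S * D) ]) × (w (s ℕ.* N) ≡ + 1 [mod S * D ])
    lift-step N D S∣D g≡D w≡1-mod-D = g-lift , w-lift
      where
      D∣G : D ∣ₛ g N
      D∣G = ∣-transfer (∣n⇒∣m*n S ∣-refl) g≡D ∣-refl
      -- m·g_N² vanishes modulo s²D because s ∣ m and sD ∣ g_N².
      bound : S * (S * D) ∣ₛ m * (g N * g N)
      bound = *-pres-∣ S∣m (*-pres-∣ (∣-trans S∣D D∣G) D∣G)
      ex : (g (s ℕ.* N) ≡ S * g N * w N ^ s₀ [mod S * (S * D) ])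
         × (w (s ℕ.* N) ≡ w N ^ s [mod S * (S * D) ])
      ex = expansion N bound s₀
      g-lift : g (s ℕ.* N) ≡ S * D [mod S * (S * D) ]
      g-lift = begin
        g (s ℕ.* N)           ≈⟨ proj₁ ex ⟩
        S * g N * w N ^ s₀    ≈⟨ *-congʳ (w N ^ s₀) (mod-scale S g≡D) ⟩
        S * D * w N ^ s₀      ≈⟨ mod-scale-multiple ∣-refl (pow-≡1 s₀ (w≡1 S∣m N)) ⟩
        S * D * + 1           ≡⟨ ZP.*-identityʳ (S * D) ⟩
        S * D                 ∎
        where open ModReasoning (S * (S * D))
      w-lift : w (s ℕ.* N) ≡ + 1 [mod S * D ]
      w-lift = begin
        w (s ℕ.* N)   ≈⟨ mod-weaken (∣n⇒∣m*n S ∣-refl) (proj₂ ex) ⟩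
        w N ^ s       ≈⟨ pow-lift s (w N) w≡1-mod-D (w≡1 S∣m N) ⟩
        + 1           ∎
        where open ModReasoning (S * D)

    module _ (3∤s : ¬ 3 ℕD.∣ s) where

      -- The first level, g_s ≡ s (mod s²); this is where 3 ∤ s is needed,
      -- to make the term m·C(s,3) vanish.
      base : (g s ≡ S [mod S * S ]) × (w s ≡ + 1 [mod S ])
      base = g-base , w≡1 S∣m s
        where
        open ModReasoning (S * S)
        S∣C₃ : S ∣ₛ + (s C 3)
        S∣C₃ = Signed.∣ᵤ⇒∣ (∣-C₃ s 3∤s)
        g-base : g s ≡ S [mod S * S ]
        g-base = begin
          g s                 ≈⟨ mod-weaken (*-pres-∣ S∣m S∣m) (proj₁ (second-order s)) ⟩
          S + m * + (s C 3)   ≈⟨ mod-absorb S (*-pres-∣ S∣m S∣C₃) ⟩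
          S                   ∎

      lift : ∀ j → (g (s ℕ.^ suc j) ≡ S ^ suc j [mod S ^ suc (suc j) ])
                 × (w (s ℕ.^ suc j) ≡ + 1 [mod S ^ suc j ])
      lift zero = subst₂ (λ N P → (g N ≡ P [mod S * P ]) × (w N ≡ + 1 [mod P ]))
                         (sym (ℕP.*-identityʳ s)) (sym (ZP.*-identityʳ S)) base
      lift (suc j) = lift-step (s ℕ.^ suc j) (S ^ suc j) (∣m⇒∣m*n (S ^ j) ∣-refl)
                               (proj₁ (lift j)) (proj₂ (lift j))

      g-at-power : ∀ j → g (s ℕ.^ j) ≡ S ^ j [mod S ^ suc j ]
      g-at-power zero    = mod-refl
      g-at-power (suc j) = proj₁ (lift j)

      g≡n-lifted : ∀ j n → S ^ j ∣ₛ + n → g n ≡ + n [mod S ^ suc j ]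
      g≡n-lifted j n S^j∣n with pow-multiple s j n S^j∣n
      ... | r , refl = mod-trans (multiples (s ℕ.^ j) (S ^ j) (g-at-power j) r) (mod-reflexive cast)
        where
        cast : + r * S ^ j ≡ + (r ℕ.* s ℕ.^ j)
        cast = trans (cong (+ r *_) (sym (pos-pow s j))) (sym (ZP.pos-* r (s ℕ.^ j)))

      power-divisibility : ∀ k n → S ^ k ∣ₛ + n ⇔ S ^ k ∣ₛ g n
      power-divisibility zero    n = mk⇔ (λ _ → 1∣ (g n)) (λ _ → 1∣ (+ n))
      power-divisibility (suc j) n = mk⇔ to from
        where
        S^j∣S^j+1 : S ^ j ∣ₛ S ^ suc j
        S^j∣S^j+1 = ∣n⇒∣m*n S ∣-refl
        to : S ^ suc j ∣ₛ + n → S ^ suc j ∣ₛ g n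
        to d = Equivalence.from (mod-divides (g≡n-lifted j n (∣-trans S^j∣S^j+1 d))) d
        from : S ^ suc j ∣ₛ g n → S ^ suc j ∣ₛ + n
        from d = Equivalence.to (mod-divides (g≡n-lifted j n S^j∣n)) d
          where
          S^j∣n : S ^ j ∣ₛ + n
          S^j∣n = Equivalence.from (power-divisibility j n) (∣-trans S^j∣S^j+1 d)

-- Reduction of the case a = 1 to the case a = 2.

-- Hₙ = 2^(n-1)·Gₙ(1, q) satisfies Hₙ₊₂ = 2Hₙ₊₁ + 4q·Hₙ, hence Hₙ = Gₙ(2, 4q).
doubling : ∀ q n → ((+ 2) ^ n * G (+ 1) q n ≡ + 2 * G (+ 2) (+ 4 * q) n)
                 × ((+ 2) ^ suc n * G (+ 1) q (suc n) ≡ + 2 * G (+ 2) (+ 4 * q) (suc n))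
doubling q zero    = refl , refl
doubling q (suc n) = proj₂ ih , (begin
  (+ 2) ^ suc (suc n) * G (+ 1) q (suc (suc n))
    ≡⟨ distribute ((+ 2) ^ n) q (G (+ 1) q (suc n)) (G (+ 1) q n) ⟩
  + 2 * ((+ 2) ^ suc n * G (+ 1) q (suc n)) + (+ 4 * q) * ((+ 2) ^ n * G (+ 1) q n)
    ≡⟨ cong₂ (λ x y → + 2 * x + (+ 4 * q) * y) (proj₂ ih) (proj₁ ih) ⟩
  + 2 * (+ 2 * G (+ 2) (+ 4 * q) (suc n)) + (+ 4 * q) * (+ 2 * G (+ 2) (+ 4 * q) n)
    ≡⟨ factor q (G (+ 2) (+ 4 * q) (suc n)) (G (+ 2) (+ 4 * q) n) ⟩
  + 2 * G (+ 2) (+ 4 * q) (suc (suc n))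
    ∎)
  where
  open ≡-Reasoning
  ih : ((+ 2) ^ n * G (+ 1) q n ≡ + 2 * G (+ 2) (+ 4 * q) n)
     × ((+ 2) ^ suc n * G (+ 1) q (suc n) ≡ + 2 * G (+ 2) (+ 4 * q) (suc n))
  ih = doubling q n
  distribute : ∀ X q a b → + 2 * (+ 2 * X) * (+ 1 * a + q * b)
                           ≡ + 2 * (+ 2 * X * a) + (+ 4 * q) * (X * b)
  distribute = ℤRing.solve-∀
  factor : ∀ q x y → + 2 * (+ 2 * x) + (+ 4 * q) * (+ 2 * y) ≡ + 2 * (+ 2 * x + (+ 4 * q) * y)
  factor = ℤRing.solve-∀

Odd : ℤ → Set
Odd P = Σ ℤ λ U → P ≡ + 1 + + 2 * U

odd-cancel-2 : ∀ {P} x → Odd P → P ∣ₛ + 2 * x → P ∣ₛ x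
odd-cancel-2 x (U , refl) P∣2x =
  ∣-by (combination U x) (Signed.∣m∣n⇒∣m-n (∣m⇒∣m*n x ∣-refl) (∣n⇒∣m*n U P∣2x))
  where
  combination : ∀ U x → x ≡ (+ 1 + + 2 * U) * x - U * (+ 2 * x)
  combination = ℤRing.solve-∀

odd-cancel-pow-2 : ∀ {P} n x → Odd P → P ∣ₛ (+ 2) ^ n * x → P ∣ₛ x
odd-cancel-pow-2 zero    x _   P∣x = ∣-by (sym (ZP.*-identityˡ x)) P∣x
odd-cancel-pow-2 (suc n) x odd P∣2ⁿ⁺¹x = odd-cancel-pow-2 n x odd
  (odd-cancel-2 ((+ 2) ^ n * x) odd (∣-by (sym (ZP.*-assoc (+ 2) ((+ 2) ^ n) x)) P∣2ⁿ⁺¹x))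

odd-pow : ∀ {P} k → Odd P → Odd (P ^ k)
odd-pow zero    _ = + 0 , refl
odd-pow (suc k) (U , refl) with odd-pow k (U , refl)
... | V , eq = U + V + + 2 * U * V , trans (cong ((+ 1 + + 2 * U) *_) eq) (product U V)
  where
  product : ∀ U V → (+ 1 + + 2 * U) * (+ 1 + + 2 * V) ≡ + 1 + + 2 * (U + V + + 2 * U * V)
  product = ℤRing.solve-∀

transfer : ∀ {P} q n → Odd P → P ∣ₛ G (+ 1) q n ⇔ P ∣ₛ G (+ 2) (+ 4 * q) n
transfer {P} q n odd = mk⇔
  (λ d → odd-cancel-2 _ odd (∣-by (sym (proj₁ (doubling q n))) (∣n⇒∣m*n ((+ 2) ^ n) d)))
  (λ d → odd-cancel-pow-2 n _ odd (∣-by (proj₁ (doubling q n)) (∣n⇒∣m*n (+ 2) d)))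

parity : ∀ n → Σ ℕ (λ u → n ≡ u ℕ.+ u) ⊎ Σ ℕ (λ u → n ≡ suc (u ℕ.+ u))
parity zero = inj₁ (0 , refl)
parity (suc n) with parity n
... | inj₁ (u , refl) = inj₂ (u , refl)
... | inj₂ (u , refl) = inj₁ (suc u , cong suc (sym (ℕP.+-suc u u)))

2∤4q+1 : ∀ q → ¬ (+ 2 ∣ₛ + 4 * q + + 1)
2∤4q+1 q 2∣4q+1 = 2≢1 (ℕD.∣1⇒≡1 (Signed.∣⇒∣ᵤ 2∣1))
  where
  2≢1 : ¬ 2 ≡ 1
  2≢1 ()
  2∣1 : + 2 ∣ₛ + 1
  2∣1 = ∣-by (unit q) (Signed.∣m∣n⇒∣m-n 2∣4q+1 (divides (+ 2 * q) (quadruple q)))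
    where
    unit : ∀ q → + 1 ≡ + 4 * q + + 1 - + 4 * q
    unit = ℤRing.solve-∀
    quadruple : ∀ q → + 4 * q ≡ + 2 * q * + 2
    quadruple = ℤRing.solve-∀

divisor-of-4q+1-odd : ∀ s q → + s ∣ₛ + 4 * q + + 1 → Odd (+ s)
divisor-of-4q+1-odd s q s∣4q+1 with parity s
... | inj₂ (u , refl) = + u , odd-form (+ u)
  where
  odd-form : ∀ u → + 1 + u + u ≡ + 1 + + 2 * u
  odd-form = ℤRing.solve-∀
... | inj₁ (u , refl) = ⊥-elim (2∤4q+1 q (∣-trans (divides (+ u) (double (+ u))) s∣4q+1))
  where
  double : ∀ u → u + u ≡ u * + 2
  double = ℤRing.solve-∀

three-∤-s : ∀ {s X Y} → + s ∣ₛ X → (+ 3 ∣ₛ X → + 3 ∣ₛ Y)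
          → ¬ (+ 3 ∣ Y) ⊎ ¬ (+ 3 ∣ + s) → ¬ 3 ℕD.∣ s
three-∤-s s∣X 3∣X⇒3∣Y (inj₁ 3∤Y) 3∣s =
  3∤Y (Signed.∣⇒∣ᵤ (3∣X⇒3∣Y (∣-trans (Signed.∣ᵤ⇒∣ 3∣s) s∣X)))
three-∤-s _ _ (inj₂ 3∤s) = 3∤s

3∣4q+1⇒3∣q+1 : ∀ q → + 3 ∣ₛ + 4 * q + + 1 → + 3 ∣ₛ q + + 1
3∣4q+1⇒3∣q+1 q 3∣4q+1 = ∣-by (three-q q) (Signed.∣m∣n⇒∣m-n 3∣4q+1 (∣n⇒∣m*n q ∣-refl))
  where
  three-q : ∀ q → q + + 1 ≡ + 4 * q + + 1 - q * + 3
  three-q = ℤRing.solve-∀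

-- The statement uses the unsigned divisibility relation.
unsigned : ∀ {a b c d} → (a ∣ₛ b ⇔ c ∣ₛ d) → (a ∣ b ⇔ c ∣ d)
unsigned e = mk⇔ (λ x → Signed.∣⇒∣ᵤ (Equivalence.to e (Signed.∣ᵤ⇒∣ x)))
                 (λ y → Signed.∣⇒∣ᵤ (Equivalence.from e (Signed.∣ᵤ⇒∣ y)))

corollary1p6 : (q a : ℤ) (s : ℕ) → s ≥ 1 →
    ((a ≡ + 1 × (+ s) ∣ (+ 4 * q + + 1)) ⊎ (a ≡ + 2 × (+ s) ∣ (q + + 1))) →
    ((n : ℕ) → ((+ s) ∣ (+ n) ⇔ (+ s) ∣ G a q n))
    × ((¬ ((+ 3) ∣ (q + + 1)) ⊎ ¬ ((+ 3) ∣ (+ s))) →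
    (k n : ℕ) → ((+ s) ^ k ∣ (+ n) ⇔ (+ s) ^ k ∣ G a q n))
corollary1p6 q a (suc s₀) (s≤s z≤n) (inj₂ (refl , s∣q+1)) = part1 , part2
  where
  s∣m : + suc s₀ ∣ₛ q + + 1
  s∣m = Signed.∣ᵤ⇒∣ s∣q+1
  part1 : ∀ n → + suc s₀ ∣ + n ⇔ + suc s₀ ∣ G (+ 2) q n
  part1 n = unsigned (LucasSequence.divisibility q s∣m n)
  part2 : ¬ (+ 3 ∣ q + + 1) ⊎ ¬ (+ 3 ∣ + suc s₀) →
          ∀ k n → (+ suc s₀) ^ k ∣ + n ⇔ (+ suc s₀) ^ k ∣ G (+ 2) q n
  part2 3∤ k n = unsigned (Lifting.power-divisibility q s₀ s∣m (three-∤-s s∣m (λ d → d) 3∤) k n)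
corollary1p6 q a (suc s₀) (s≤s z≤n) (inj₁ (refl , s∣4q+1)) = part1 , part2
  where
  s∣m : + suc s₀ ∣ₛ + 4 * q + + 1
  s∣m = Signed.∣ᵤ⇒∣ s∣4q+1
  odd : Odd (+ suc s₀)
  odd = divisor-of-4q+1-odd (suc s₀) q s∣m
  part1 : ∀ n → + suc s₀ ∣ + n ⇔ + suc s₀ ∣ G (+ 1) q n
  part1 n = unsigned (⇔-trans (LucasSequence.divisibility (+ 4 * q) s∣m n)
                              (⇔-sym (transfer q n odd)))
  part2 : ¬ (+ 3 ∣ q + + 1) ⊎ ¬ (+ 3 ∣ + suc s₀) →
          ∀ k n → (+ suc s₀) ^ k ∣ + n ⇔ (+ suc s₀) ^ k ∣ G (+ 1) q n
  part2 3∤ k n = unsigned (⇔-trans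
            (Lifting.power-divisibility (+ 4 * q) s₀ s∣m (three-∤-s s∣m (3∣4q+1⇒3∣q+1 q) 3∤) k n)
            (⇔-sym (transfer q n (odd-pow k odd))))
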